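{- Let $G^c$ be an edge-colored bipartite graph with bipartition $(A,B)$. If $d^c(u)\geq (3|B|+8)/5$ for each $u\in A$ and $d^c(v)\geq (3|A|+8)/5$ for each $v\in B$, then $G^c$ contains a rainbow cycle of length $4$.
   Context: $G$ is a finite simple graph and an edge-coloring is an arbitrary map $C:E(G)\to\mathbb{N}^{+}$ (not necessarily proper); $G^c$ denotes $G$ with such a coloring. The color degree $d^c(v)$ of a vertex $v$ is the number of distinct colors appearing on the edges incident to $v$. A subgraph is rainbow if all of its edges receive pairwise distinct colors. -}

module Defs where

open import Data.Nat using (ℕ; _≟_)
open import Data.Bool using (Bool; T; T?)
open import Data.Fin using (Fin)
open import Data.List using (List; map; filter; length; deduplicate; allFin)
open import Data.Product using (_×_; ∃-syntax)
open import Relation.Binary.PropositionalEquality using (_≢_)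

-- An edge-colored bipartite (simple) graph with bipartition (A , B),
-- A = Fin a, B = Fin b.  adj i j = true iff i ∈ A and j ∈ B are adjacent
-- (edges only go between A and B, at most one per pair: simple graph).
-- col i j is the colour of the edge ij (its value on non-edges is irrelevant).
record BipColGraph (a b : ℕ) : Set where
  field
    adj : Fin a → Fin b → Bool
    col : Fin a → Fin b → ℕ

open BipColGraph public

coloursA : ∀ {a b} → BipColGraph a b → Fin a → List ℕ
coloursA {a} {b} G u = map (col G u) (filter (λ v → T? (adj G u v)) (allFin b))

coloursB : ∀ {a b} → BipColGraph a b → Fin b → List ℕ
coloursB {a} {b} G v = map (λ u → col G u v) (filter (λ u → T? (adj G u v)) (allFin a))

dcA : ∀ {a b} → BipColGraph a b → Fin a → ℕ
dcA G u = length (deduplicate _≟_ (coloursA G u))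

dcB : ∀ {a b} → BipColGraph a b → Fin b → ℕ
dcB G v = length (deduplicate _≟_ (coloursB G v))

Distinct4 : ℕ → ℕ → ℕ → ℕ → Set
Distinct4 c₁ c₂ c₃ c₄ =
  (c₁ ≢ c₂) × (c₁ ≢ c₃) × (c₁ ≢ c₄) × (c₂ ≢ c₃) × (c₂ ≢ c₄) × (c₃ ≢ c₄)

RainbowC4 : ∀ {a b} → BipColGraph a b → Set
RainbowC4 {a} {b} G =
  ∃[ u₁ ] ∃[ u₂ ] ∃[ v₁ ] ∃[ v₂ ]
    (u₁ ≢ u₂) × (v₁ ≢ v₂) ×
    T (adj G u₁ v₁) × T (adj G u₂ v₁) × T (adj G u₂ v₂) × T (adj G u₁ v₂) ×
    Distinct4 (col G u₁ v₁) (col G u₂ v₁) (col G u₂ v₂) (col G u₁ v₂)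

module Submission where

-- The proof is a double count.  Keeping at each u ∈ A only the first edge of every colour gives a
-- spanning subgraph H in which every u spans a rainbow star with ≥ d^c(u) edges.  Call v a good common
-- neighbour of u₁, u₂ if u₁v, u₂v ∈ H have different colours.  Four good common neighbours yield a
-- rainbow C4, since the rainbow stars rule out at most three choices of the second vertex.  Otherwise
-- every pair has codegree ≤ 3, so summing over v the number of ordered pairs of H-neighbours of v
-- with different colours gives at most 3a(a − 1).  At a single v, same-coloured pairs are rare: if
-- s_v of its x_v H-neighbours are not the first edge of their colour at v, then
-- x_v² ≤ (different-colour pairs at v) + x_v + s_v + s_v², and s_v ≤ a − d^c(v).  Cauchy–Schwarz on
-- e(H) = Σ x_v ≥ Σ d^c(u) turns these bounds into a polynomial inequality in a, b that fails as soon
-- as a, b ≥ 4, which the degree conditions force.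

open import Defs
open import Data.Nat using (ℕ; zero; suc; _+_; _*_; _∸_; _≤_; _<_; z≤n; s≤s; _≟_; _≡ᵇ_; _<?_; _≤?_)
open import Data.Nat.Properties
open import Data.Nat.Tactic.RingSolver using (solve-∀)
open import Data.Bool using (Bool; true; false; T; T?; not; _∧_; _∨_)
open import Data.Bool.Properties using (T-∧; T-∨)
open import Data.Fin using (Fin; zero; suc; fromℕ<)
  renaming (_<_ to _<ᶠ_; _<?_ to _<ᶠ?_; _≟_ to _≟ᶠ_)
open import Data.Fin.Properties using (any?) renaming (<-cmp to <ᶠ-cmp; suc-injective to Fin-suc-injective)
open import Data.List using (List; []; _∷_; _++_; length; map; filter; deduplicate; allFin; tabulate)
open import Data.List.Properties using (length-++; length-map)
open import Data.List.Membership.Propositional using (_∈_)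
open import Data.List.Membership.Propositional.Properties
  using (∈-∃++; ∈-++⁻; ∈-++⁺ˡ; ∈-++⁺ʳ; ∈-map⁻; ∈-map⁺; ∈-filter⁻; ∈-filter⁺; ∈-allFin; deduplicate-∈⇔)
open import Data.List.Relation.Unary.Unique.Propositional using (Unique)
open import Data.List.Relation.Unary.Unique.DecPropositional.Properties using (deduplicate-!)
open import Data.List.Relation.Unary.AllPairs using (_∷_)
open import Data.List.Relation.Unary.All as All using ()
open import Data.List.Relation.Unary.Any using (here; there)
open import Data.Product using (∃; _×_; _,_; proj₁; proj₂)
open import Data.Sum using (inj₁; inj₂)
open import Data.Empty using (⊥; ⊥-elim)
open import Function using (_∘_; case_of_)
open import Function.Bundles using (Equivalence)
open import Relation.Nullary using (¬_; yes; no)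
open import Relation.Nullary.Decidable using (isYes; toWitness; fromWitness; ¬?; _×-dec_)
open import Relation.Unary using (Decidable)
open import Relation.Binary using (tri<; tri≈; tri>)
open import Relation.Binary.PropositionalEquality
open import Algebra.Properties.CommutativeMonoid.Sum +-0-commutativeMonoid
  using (sum; sum-syntax; ∑-distrib-+; ∑-comm; sum-cong-≗)

∑-mono-≤ : ∀ {n} {f g : Fin n → ℕ} → (∀ i → f i ≤ g i) → sum f ≤ sum g
∑-mono-≤ {zero} f≤g = z≤n
∑-mono-≤ {suc n} f≤g = +-mono-≤ (f≤g zero) (∑-mono-≤ (λ i → f≤g (suc i)))

∑-const : ∀ n k → ∑[ i < n ] k ≡ n * k
∑-const zero k = refl
∑-const (suc n) k = cong (k +_) (∑-const n k)

∑-*ˡ : ∀ {n} k (f : Fin n → ℕ) → ∑[ i < n ] (k * f i) ≡ k * sum f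
∑-*ˡ {zero} k f = sym (*-zeroʳ k)
∑-*ˡ {suc n} k f = trans (cong (k * f zero +_) (∑-*ˡ k (λ i → f (suc i))))
  (sym (*-distribˡ-+ k (f zero) _))

∑-positive : ∀ {n} (f : Fin n → ℕ) → 0 < sum f → ∃ λ i → 0 < f i
∑-positive {suc n} f pos with f zero in eq
... | suc _ = zero , subst (0 <_) (sym eq) (s≤s z≤n)
... | zero with ∑-positive (λ i → f (suc i)) pos
...   | i , fi>0 = suc i , fi>0

∑-*ʳ : ∀ {n} k (f : Fin n → ℕ) → ∑[ i < n ] (f i * k) ≡ sum f * k
∑-*ʳ k f = trans (sum-cong-≗ (λ i → *-comm (f i) k)) (trans (∑-*ˡ k f) (*-comm k _))

∑-product : ∀ {m n} (f : Fin m → ℕ) (g : Fin n → ℕ) →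
  sum f * sum g ≡ ∑[ i < m ] ∑[ j < n ] (f i * g j)
∑-product f g = trans (sym (∑-*ʳ (sum g) f)) (sum-cong-≗ (λ i → sym (∑-*ˡ (f i) g)))

-- 2xy ≤ x² + y² for x ≤ y: writing y = x + d the difference is d².
ordered-two-products≤squares : ∀ {x y} → x ≤ y → 2 * (x * y) ≤ x * x + y * y
ordered-two-products≤squares {x} {y} x≤y =
  subst (λ z → 2 * (x * z) ≤ x * x + z * z) (m+[n∸m]≡n x≤y) (with-gap x (y ∸ x))
  where
  expand : ∀ x d → 2 * (x * (x + d)) + d * d ≡ x * x + (x + d) * (x + d)
  expand = solve-∀
  with-gap : ∀ x d → 2 * (x * (x + d)) ≤ x * x + (x + d) * (x + d)
  with-gap x d = subst (2 * (x * (x + d)) ≤_) (expand x d) (m≤m+n _ (d * d))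

two-products≤squares : ∀ x y → 2 * (x * y) ≤ x * x + y * y
two-products≤squares x y with ≤-total x y
... | inj₁ x≤y = ordered-two-products≤squares x≤y
... | inj₂ y≤x = subst₂ _≤_ (cong (2 *_) (*-comm y x)) (+-comm (y * y) (x * x))
  (ordered-two-products≤squares y≤x)

-- Cauchy–Schwarz over ℕ: (Σ f)² ≤ n·Σ f², from 2·(Σ f)² = Σᵢ Σⱼ 2fᵢfⱼ ≤ Σᵢ Σⱼ (fᵢ² + fⱼ²).
cauchy-schwarz : ∀ {n} (f : Fin n → ℕ) → sum f * sum f ≤ n * ∑[ i < n ] (f i * f i)
cauchy-schwarz {n} f = *-cancelˡ-≤ 2 (begin
  2 * (sum f * sum f)                              ≡⟨ cong (2 *_) (∑-product f f) ⟩
  2 * ∑[ i < n ] ∑[ j < n ] (f i * f j)            ≡⟨ ∑-*ˡ 2 (λ i → ∑[ j < n ] (f i * f j)) ⟨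
  ∑[ i < n ] (2 * ∑[ j < n ] (f i * f j))          ≡⟨ sum-cong-≗ (λ i → ∑-*ˡ 2 (λ j → f i * f j)) ⟨
  ∑[ i < n ] ∑[ j < n ] (2 * (f i * f j))          ≤⟨ ∑-mono-≤ (λ i → ∑-mono-≤ (λ j → two-products≤squares (f i) (f j))) ⟩
  ∑[ i < n ] ∑[ j < n ] (f i * f i + f j * f j)    ≡⟨ sum-cong-≗ (λ i → ∑-distrib-+ (λ _ → f i * f i) (λ j → f j * f j)) ⟩
  ∑[ i < n ] (∑[ j < n ] (f i * f i) + Q)          ≡⟨ sum-cong-≗ (λ i → cong (_+ Q) (∑-const n (f i * f i))) ⟩
  ∑[ i < n ] (n * (f i * f i) + Q)                 ≡⟨ ∑-distrib-+ (λ i → n * (f i * f i)) (λ _ → Q) ⟩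
  ∑[ i < n ] (n * (f i * f i)) + ∑[ i < n ] Q      ≡⟨ cong₂ _+_ (∑-*ˡ n (λ i → f i * f i)) (∑-const n Q) ⟩
  n * Q + n * Q                                    ≡⟨ cong (n * Q +_) (+-identityʳ (n * Q)) ⟨
  2 * (n * Q)                                      ∎)
  where
  open ≤-Reasoning
  Q : ℕ
  Q = ∑[ i < n ] (f i * f i)

∑-vanishing-term : ∀ {n} m (f : Fin n → ℕ) (i : Fin n) → (∀ j → f j ≤ m) → f i ≡ 0 →
  sum f + m ≤ n * m
∑-vanishing-term {suc n} m f zero f≤m f0≡0 = begin
  f zero + ∑[ j < n ] f (suc j) + m ≡⟨ cong (λ z → z + ∑[ j < n ] f (suc j) + m) f0≡0 ⟩
  ∑[ j < n ] f (suc j) + m          ≡⟨ +-comm (∑[ j < n ] f (suc j)) m ⟩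
  m + ∑[ j < n ] f (suc j)          ≤⟨ +-monoʳ-≤ m (∑-mono-≤ (λ j → f≤m (suc j))) ⟩
  m + ∑[ j < n ] m                  ≡⟨ cong (m +_) (∑-const n m) ⟩
  m + n * m                         ∎
  where open ≤-Reasoning
∑-vanishing-term {suc n} m f (suc i) f≤m fi≡0 = begin
  f zero + ∑[ j < n ] f (suc j) + m   ≡⟨ +-assoc (f zero) _ m ⟩
  f zero + (∑[ j < n ] f (suc j) + m) ≤⟨ +-mono-≤ (f≤m zero) (∑-vanishing-term m (λ j → f (suc j)) i (λ j → f≤m (suc j)) fi≡0) ⟩
  m + n * m                           ∎
  where open ≤-Reasoning

ι : Bool → ℕ
ι true = 1
ι false = 0

ι≤1 : ∀ x → ι x ≤ 1
ι≤1 true = ≤-refl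
ι≤1 false = z≤n

ι-∧ : ∀ x y → ι (x ∧ y) ≡ ι x * ι y
ι-∧ true y = sym (+-identityʳ (ι y))
ι-∧ false y = refl

ι-split : ∀ x y → ι x ≡ ι (x ∧ y) + ι (x ∧ not y)
ι-split true true = refl
ι-split true false = refl
ι-split false y = refl

ι-not : ∀ x → ι (not x) + ι x ≡ 1
ι-not true = refl
ι-not false = refl

ι-∨ : ∀ x y → ι (x ∨ y) ≤ ι x + ι y
ι-∨ true y = s≤s z≤n
ι-∨ false y = ≤-refl

ι-∧-≤ʳ : ∀ x y → ι (x ∧ y) ≤ ι y
ι-∧-≤ʳ true y = ≤-refl
ι-∧-≤ʳ false y = z≤n

T-not⇒¬T : ∀ {x} → T (not x) → ¬ T x
T-not⇒¬T {false} _ ()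

ι-mono : ∀ {x y} → (T x → T y) → ι x ≤ ι y
ι-mono {false} x⇒y = z≤n
ι-mono {true} {true} x⇒y = ≤-refl
ι-mono {true} {false} x⇒y = ⊥-elim (x⇒y _)

ι-positive : ∀ {x} → 0 < ι x → T x
ι-positive {true} _ = _

count : ∀ {n} → (Fin n → Bool) → ℕ
count {n} P = ∑[ i < n ] ι (P i)

count-mono : ∀ {n} {P Q : Fin n → Bool} → (∀ i → T (P i) → T (Q i)) → count P ≤ count Q
count-mono P⇒Q = ∑-mono-≤ (λ i → ι-mono (P⇒Q i))

count-complement : ∀ {n} (P : Fin n → Bool) → count (λ i → not (P i)) + count P ≡ n
count-complement {n} P = begin
  count (λ i → not (P i)) + count P   ≡⟨ ∑-distrib-+ (λ i → ι (not (P i))) (λ i → ι (P i)) ⟨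
  ∑[ i < n ] (ι (not (P i)) + ι (P i)) ≡⟨ sum-cong-≗ (λ i → ι-not (P i)) ⟩
  ∑[ i < n ] 1                         ≡⟨ ∑-const n 1 ⟩
  n * 1                                ≡⟨ *-identityʳ n ⟩
  n                                    ∎
  where open ≡-Reasoning

count-≤-size : ∀ {n} (P : Fin n → Bool) → count P ≤ n
count-≤-size {n} P = ≤-trans (m≤n+m (count P) _) (≤-reflexive (count-complement P))

count-∨ : ∀ {n} (P Q : Fin n → Bool) → count (λ i → P i ∨ Q i) ≤ count P + count Q
count-∨ P Q = ≤-trans (∑-mono-≤ (λ i → ι-∨ (P i) (Q i)))
  (≤-reflexive (∑-distrib-+ (λ i → ι (P i)) (λ i → ι (Q i))))

count-none : ∀ {n} (P : Fin n → Bool) → (∀ i → ¬ T (P i)) → count P ≡ 0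
count-none {zero} P never = refl
count-none {suc n} P never with P zero in eq
... | true = ⊥-elim (never zero (subst T (sym eq) _))
... | false = count-none (λ i → P (suc i)) (λ i → never (suc i))

count-≤1 : ∀ {n} (P : Fin n → Bool) → (∀ i j → T (P i) → T (P j) → i ≡ j) → count P ≤ 1
count-≤1 {zero} P unique = z≤n
count-≤1 {suc n} P unique with P zero in eq
... | false = count-≤1 (λ i → P (suc i))
      (λ i j Pi Pj → Fin-suc-injective (unique (suc i) (suc j) Pi Pj))
... | true = ≤-reflexive (cong suc (count-none (λ i → P (suc i)) nothing-else))
  where
  nothing-else : ∀ i → ¬ T (P (suc i))
  nothing-else i Psi with unique zero (suc i) (subst T (sym eq) _) Psi
  ... | ()

count-positive : ∀ {n} (P : Fin n → Bool) → 0 < count P → ∃ λ i → T (P i)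
count-positive P pos = let i , ιPi>0 = ∑-positive (λ i → ι (P i)) pos in i , ι-positive ιPi>0

count-split : ∀ {n} (P Q : Fin n → Bool) → count P ≤ count (λ i → P i ∧ not (Q i)) + count Q
count-split {n} P Q = ≤-trans (∑-mono-≤ split) (≤-reflexive (∑-distrib-+ (λ i → ι (P∖Q i)) (λ i → ι (Q i))))
  where
  P∖Q : Fin n → Bool
  P∖Q i = P i ∧ not (Q i)
  split : ∀ i → ι (P i) ≤ ι (P∖Q i) + ι (Q i)
  split i = begin
    ι (P i)                    ≡⟨ ι-split (P i) (Q i) ⟩
    ι (P i ∧ Q i) + ι (P∖Q i)   ≡⟨ +-comm (ι (P i ∧ Q i)) _ ⟩
    ι (P∖Q i) + ι (P i ∧ Q i)   ≤⟨ +-monoʳ-≤ (ι (P∖Q i)) (ι-∧-≤ʳ (P i) (Q i)) ⟩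
    ι (P∖Q i) + ι (Q i)         ∎
    where open ≤-Reasoning

escape : ∀ {n} (P Q : Fin n → Bool) → count Q < count P → ∃ λ i → T (P i) × ¬ T (Q i)
escape P Q Q<P =
  let i , t = count-positive (λ i → P i ∧ not (Q i))
                (+-cancelʳ-< (count Q) 0 _ (<-≤-trans Q<P (count-split P Q)))
      Pi , ¬Qi = Equivalence.to (T-∧ {P i}) t
  in i , Pi , T-not⇒¬T ¬Qi

pairSum : ∀ {n} → (Fin n → Fin n → ℕ) → (Fin n → ℕ) → (Fin n → ℕ) → ℕ
pairSum {n} w f g = ∑[ i < n ] ∑[ j < n ] (f i * g j * w i j)

∑∑-distrib-+ : ∀ {m n} (F G : Fin m → Fin n → ℕ) →
  ∑[ i < m ] ∑[ j < n ] (F i j + G i j) ≡ ∑[ i < m ] ∑[ j < n ] F i j + ∑[ i < m ] ∑[ j < n ] G i j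
∑∑-distrib-+ {m} {n} F G = trans (sum-cong-≗ (λ i → ∑-distrib-+ (F i) (G i)))
  (∑-distrib-+ (λ i → ∑[ j < n ] F i j) (λ i → ∑[ j < n ] G i j))

pairSum-cong : ∀ {n} {w w' : Fin n → Fin n → ℕ} {f f' g g' : Fin n → ℕ} →
  (∀ i j → w i j ≡ w' i j) → (∀ i → f i ≡ f' i) → (∀ j → g j ≡ g' j) →
  pairSum w f g ≡ pairSum w' f' g'
pairSum-cong w≗w' f≗f' g≗g' = sum-cong-≗ (λ i → sum-cong-≗ (λ j →
  cong₂ _*_ (cong₂ _*_ (f≗f' i) (g≗g' j)) (w≗w' i j)))

pairSum-+ʷ : ∀ {n} (w₁ w₂ : Fin n → Fin n → ℕ) f g →
  pairSum (λ i j → w₁ i j + w₂ i j) f g ≡ pairSum w₁ f g + pairSum w₂ f g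
pairSum-+ʷ w₁ w₂ f g = trans
  (sum-cong-≗ (λ i → sum-cong-≗ (λ j → *-distribˡ-+ (f i * g j) (w₁ i j) (w₂ i j))))
  (∑∑-distrib-+ (λ i j → f i * g j * w₁ i j) (λ i j → f i * g j * w₂ i j))

pairSum-+ˡ : ∀ {n} w (f₁ f₂ g : Fin n → ℕ) →
  pairSum w (λ i → f₁ i + f₂ i) g ≡ pairSum w f₁ g + pairSum w f₂ g
pairSum-+ˡ w f₁ f₂ g = trans
  (sum-cong-≗ (λ i → sum-cong-≗ (λ j → distrib (f₁ i) (f₂ i) (g j) (w i j))))
  (∑∑-distrib-+ (λ i j → f₁ i * g j * w i j) (λ i j → f₂ i * g j * w i j))
  where
  distrib : ∀ x y z v → (x + y) * z * v ≡ x * z * v + y * z * v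
  distrib = solve-∀

pairSum-+ʳ : ∀ {n} w (f g₁ g₂ : Fin n → ℕ) →
  pairSum w f (λ j → g₁ j + g₂ j) ≡ pairSum w f g₁ + pairSum w f g₂
pairSum-+ʳ w f g₁ g₂ = trans
  (sum-cong-≗ (λ i → sum-cong-≗ (λ j → distrib (f i) (g₁ j) (g₂ j) (w i j))))
  (∑∑-distrib-+ (λ i j → f i * g₁ j * w i j) (λ i j → f i * g₂ j * w i j))
  where
  distrib : ∀ x y z v → x * (y + z) * v ≡ x * y * v + x * z * v
  distrib = solve-∀

pairSum-one : ∀ {n} (f g : Fin n → ℕ) → pairSum (λ _ _ → 1) f g ≡ sum f * sum g
pairSum-one f g = trans (sum-cong-≗ (λ i → sum-cong-≗ (λ j → *-identityʳ (f i * g j))))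
  (sym (∑-product f g))

pairSum-≤ˡ : ∀ {n} w (f g : Fin n → ℕ) → (∀ j → ∑[ i < n ] (f i * w i j) ≤ 1) →
  pairSum w f g ≤ sum g
pairSum-≤ˡ {n} w f g column≤1 = begin
  pairSum w f g                               ≡⟨ ∑-comm (λ i j → f i * g j * w i j) ⟩
  ∑[ j < n ] ∑[ i < n ] (f i * g j * w i j)   ≡⟨ sum-cong-≗ (λ j → sum-cong-≗ (λ i → reorder (f i) (g j) (w i j))) ⟩
  ∑[ j < n ] ∑[ i < n ] (g j * (f i * w i j)) ≡⟨ sum-cong-≗ (λ j → ∑-*ˡ (g j) (λ i → f i * w i j)) ⟩
  ∑[ j < n ] (g j * ∑[ i < n ] (f i * w i j)) ≤⟨ ∑-mono-≤ (λ j → *-monoʳ-≤ (g j) (column≤1 j)) ⟩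
  ∑[ j < n ] (g j * 1)                        ≡⟨ sum-cong-≗ (λ j → *-identityʳ (g j)) ⟩
  sum g                                       ∎
  where
  open ≤-Reasoning
  reorder : ∀ x y z → x * y * z ≡ y * (x * z)
  reorder = solve-∀

pairSum-≤ʳ : ∀ {n} w (f g : Fin n → ℕ) → (∀ i → ∑[ j < n ] (g j * w i j) ≤ 1) →
  pairSum w f g ≤ sum f
pairSum-≤ʳ {n} w f g row≤1 = begin
  pairSum w f g                               ≡⟨ sum-cong-≗ (λ i → sum-cong-≗ (λ j → *-assoc (f i) (g j) (w i j))) ⟩
  ∑[ i < n ] ∑[ j < n ] (f i * (g j * w i j)) ≡⟨ sum-cong-≗ (λ i → ∑-*ˡ (f i) (λ j → g j * w i j)) ⟩
  ∑[ i < n ] (f i * ∑[ j < n ] (g j * w i j)) ≤⟨ ∑-mono-≤ (λ i → *-monoʳ-≤ (f i) (row≤1 i)) ⟩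
  ∑[ i < n ] (f i * 1)                        ≡⟨ sum-cong-≗ (λ i → *-identityʳ (f i)) ⟩
  sum f                                       ∎
  where open ≤-Reasoning

pairSum-≤-product : ∀ {n} w (f g : Fin n → ℕ) → (∀ i j → w i j ≤ 1) →
  pairSum w f g ≤ sum f * sum g
pairSum-≤-product w f g w≤1 = ≤-trans
  (∑-mono-≤ (λ i → ∑-mono-≤ (λ j → *-monoʳ-≤ (f i * g j) (w≤1 i j))))
  (≤-reflexive (pairSum-one f g))

-- Ordered pairs at one vertex, grouped by colour.  Here c assigns colours to n objects (the edges
-- at a vertex); R is rainbow if c is injective on it.
module ColourClasses {n} (c : Fin n → ℕ) where

  same differ : Fin n → Fin n → ℕ
  same i j = ι (c i ≡ᵇ c j)
  differ i j = ι (not (c i ≡ᵇ c j))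

  Rainbow : (Fin n → Bool) → Set
  Rainbow R = ∀ i j → T (R i) → T (R j) → c i ≡ c j → i ≡ j

  rainbow-colour-once : ∀ {R} → Rainbow R → ∀ κ → count (λ j → R j ∧ (c j ≡ᵇ κ)) ≤ 1
  rainbow-colour-once {R} rainbow κ = count-≤1 (λ j → R j ∧ (c j ≡ᵇ κ)) λ i j ti tj →
    let (Ri , ci≡κ) = Equivalence.to T-∧ ti
        (Rj , cj≡κ) = Equivalence.to T-∧ tj
    in rainbow i j Ri Rj (trans (≡ᵇ⇒≡ (c i) κ ci≡κ) (sym (≡ᵇ⇒≡ (c j) κ cj≡κ)))

  -- Splitting X into X ∩ R (ρ) and X ∖ R (σ): a same-coloured pair (i, j) either has i ∈ R, and
  -- then i is determined by j, or i ∉ R and j ∈ R, and then j is determined by i, or i, j ∉ R.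
  module _ (X R : Fin n → Bool) (R-rainbow : Rainbow R) where

    χ ρ σ : Fin n → ℕ
    χ i = ι (X i)
    ρ i = ι (X i ∧ R i)
    σ i = ι (X i ∧ not (R i))

    s : ℕ
    s = count (λ i → X i ∧ not (R i))

    ρ-weight : ∀ j {b} κ → (T b → c j ≡ κ) → ρ j * ι b ≤ ι (R j ∧ (c j ≡ᵇ κ))
    ρ-weight j {b} κ b⇒c≡κ = ≤-trans (≤-reflexive (sym (ι-∧ (X j ∧ R j) b))) (ι-mono λ t →
      let (XRj , tb) = Equivalence.to T-∧ t
      in Equivalence.from T-∧ (proj₂ (Equivalence.to T-∧ XRj) , ≡⇒≡ᵇ (c j) κ (b⇒c≡κ tb)))

    ρ-column : ∀ j → ∑[ i < n ] (ρ i * same i j) ≤ 1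
    ρ-column j = ≤-trans (∑-mono-≤ (λ i → ρ-weight i (c j) (≡ᵇ⇒≡ (c i) (c j))))
      (rainbow-colour-once R-rainbow (c j))

    ρ-row : ∀ i → ∑[ j < n ] (ρ j * same i j) ≤ 1
    ρ-row i = ≤-trans (∑-mono-≤ (λ j → ρ-weight j (c i) (sym ∘ ≡ᵇ⇒≡ (c i) (c j))))
      (rainbow-colour-once R-rainbow (c i))

    same-colour-pairs : pairSum same χ χ ≤ count X + (s + s * s)
    same-colour-pairs = begin
      pairSum same χ χ                              ≡⟨ pairSum-cong {w = same} {g = χ} (λ _ _ → refl) χ≗ρ+σ (λ _ → refl) ⟩
      pairSum same (λ i → ρ i + σ i) χ              ≡⟨ pairSum-+ˡ same ρ σ χ ⟩
      pairSum same ρ χ + pairSum same σ χ           ≤⟨ +-monoˡ-≤ _ (pairSum-≤ˡ same ρ χ ρ-column) ⟩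
      count X + pairSum same σ χ                    ≡⟨ cong (count X +_) (pairSum-cong {w = same} {f = σ} (λ _ _ → refl) (λ _ → refl) χ≗ρ+σ) ⟩
      count X + pairSum same σ (λ j → ρ j + σ j)    ≡⟨ cong (count X +_) (pairSum-+ʳ same σ ρ σ) ⟩
      count X + (pairSum same σ ρ + pairSum same σ σ)
        ≤⟨ +-monoʳ-≤ (count X) (+-mono-≤ (pairSum-≤ʳ same σ ρ ρ-row)
                                         (pairSum-≤-product same σ σ (λ i j → ι≤1 (c i ≡ᵇ c j)))) ⟩
      count X + (s + s * s)                          ∎
      where
      open ≤-Reasoning
      χ≗ρ+σ : ∀ i → χ i ≡ ρ i + σ i
      χ≗ρ+σ i = ι-split (X i) (R i)

    local-bound : count X * count X ≤ pairSum differ χ χ + (count X + (s + s * s))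
    local-bound = begin
      count X * count X                             ≡⟨ pairSum-one χ χ ⟨
      pairSum (λ _ _ → 1) χ χ                       ≡⟨ pairSum-cong {f = χ} {g = χ} (λ i j → sym (ι-not (c i ≡ᵇ c j))) (λ _ → refl) (λ _ → refl) ⟩
      pairSum (λ i j → differ i j + same i j) χ χ   ≡⟨ pairSum-+ʷ differ same χ χ ⟩
      pairSum differ χ χ + pairSum same χ χ         ≤⟨ +-monoʳ-≤ (pairSum differ χ χ) same-colour-pairs ⟩
      pairSum differ χ χ + (count X + (s + s * s))  ∎
      where open ≤-Reasoning

unique-⊆-length : ∀ {A : Set} {xs ys : List A} → Unique xs → (∀ {z} → z ∈ xs → z ∈ ys) →
  length xs ≤ length ys
unique-⊆-length {xs = []} _ _ = z≤n
unique-⊆-length {xs = x ∷ xs} {ys} (x∉xs ∷ xs!) xs⊆ys with ∈-∃++ (xs⊆ys (here refl))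
... | ys₁ , ys₂ , refl = begin
  suc (length xs)              ≤⟨ s≤s (unique-⊆-length xs! xs⊆ys₁++ys₂) ⟩
  suc (length (ys₁ ++ ys₂))    ≡⟨ cong suc (length-++ ys₁) ⟩
  suc (length ys₁ + length ys₂) ≡⟨ +-suc (length ys₁) (length ys₂) ⟨
  length ys₁ + suc (length ys₂) ≡⟨ length-++ ys₁ ⟨
  length (ys₁ ++ x ∷ ys₂)      ∎
  where
  open ≤-Reasoning
  xs⊆ys₁++ys₂ : ∀ {z} → z ∈ xs → z ∈ ys₁ ++ ys₂
  xs⊆ys₁++ys₂ z∈xs with ∈-++⁻ ys₁ (xs⊆ys (there z∈xs))
  ... | inj₁ z∈ys₁ = ∈-++⁺ˡ z∈ys₁
  ... | inj₂ (here refl) = ⊥-elim (All.lookup x∉xs z∈xs refl)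
  ... | inj₂ (there z∈ys₂) = ∈-++⁺ʳ ys₁ z∈ys₂

length-filter-tabulate : ∀ {A : Set} {P : A → Set} {n} (f : Fin n → A) (P? : Decidable P) →
  length (filter P? (tabulate f)) ≡ count (λ i → isYes (P? (f i)))
length-filter-tabulate {n = zero} f P? = refl
length-filter-tabulate {n = suc n} f P? with P? (f zero)
... | yes _ = cong suc (length-filter-tabulate (λ i → f (suc i)) P?)
... | no _ = length-filter-tabulate (λ i → f (suc i)) P?

least-witness : ∀ {n} {Q : Fin n → Set} → Decidable Q → ∀ v → Q v →
  ∃ λ w → Q w × (∀ j → j <ᶠ w → ¬ Q j)
least-witness {suc n} Q? v Qv with Q? zero
... | yes Q0 = zero , Q0 , λ _ ()
least-witness {suc n} Q? zero Qv | no ¬Q0 = ⊥-elim (¬Q0 Qv)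
least-witness {suc n} {Q} Q? (suc v) Qv | no ¬Q0 with least-witness (λ i → Q? (suc i)) v Qv
... | w , Qw , below = suc w , Qw , minimal
  where
  minimal : ∀ j → j <ᶠ suc w → ¬ Q j
  minimal zero _ = ¬Q0
  minimal (suc j) (s≤s j<w) = below j j<w

module FirstOccurrences {n} (adj : Fin n → Bool) (c : Fin n → ℕ) where

  IsFirst : Fin n → Set
  IsFirst i = T (adj i) × ¬ (∃ λ j → j <ᶠ i × T (adj j) × c j ≡ c i)

  isFirst? : Decidable IsFirst
  isFirst? i = T? (adj i) ×-dec ¬? (any? (λ j → (j <ᶠ? i) ×-dec (T? (adj j) ×-dec (c j ≟ c i))))

  first : Fin n → Bool
  first i = isYes (isFirst? i)

  first-sound : ∀ {i} → T (first i) → IsFirst i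
  first-sound {i} = toWitness {a? = isFirst? i}

  first⇒adj : ∀ {i} → T (first i) → T (adj i)
  first⇒adj t = proj₁ (first-sound t)

  first-rainbow : ∀ i j → T (first i) → T (first j) → c i ≡ c j → i ≡ j
  first-rainbow i j ti tj ci≡cj with <ᶠ-cmp i j
  ... | tri< i<j _ _ = ⊥-elim (proj₂ (first-sound tj) (i , i<j , first⇒adj ti , ci≡cj))
  ... | tri≈ _ i≡j _ = i≡j
  ... | tri> _ _ j<i = ⊥-elim (proj₂ (first-sound ti) (j , j<i , first⇒adj tj , sym ci≡cj))

  colours : List ℕ
  colours = map c (filter (λ v → T? (adj v)) (allFin n))

  distinct-colours≤first : length (deduplicate _≟_ colours) ≤ count first
  distinct-colours≤first = begin
    length (deduplicate _≟_ colours)  ≤⟨ unique-⊆-length (deduplicate-! _≟_ colours) covered ⟩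
    length firstColours               ≡⟨ length-map c (filter isFirst? (allFin n)) ⟩
    length (filter isFirst? (allFin n)) ≡⟨ length-filter-tabulate (λ i → i) isFirst? ⟩
    count first                       ∎
    where
    open ≤-Reasoning
    firstColours : List ℕ
    firstColours = map c (filter isFirst? (allFin n))
    covered : ∀ {κ} → κ ∈ deduplicate _≟_ colours → κ ∈ firstColours
    covered κ∈ with ∈-map⁻ c (Equivalence.from (deduplicate-∈⇔ _≟_ {colours}) κ∈)
    ... | v , v∈ , refl with least-witness (λ j → T? (adj j) ×-dec (c j ≟ c v)) v
           (proj₂ (∈-filter⁻ (λ v → T? (adj v)) {xs = allFin n} v∈) , refl)
    ... | w , (adj-w , cw≡cv) , minimal =
      subst (_∈ firstColours) cw≡cv (∈-map⁺ c (∈-filter⁺ isFirst? (∈-allFin w)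
        (adj-w , λ { (j , j<w , adj-j , cj≡cw) → minimal j j<w (adj-j , trans cj≡cw cw≡cv) })))

-- y² − c·y is increasing for y ≥ c/2, so an upper bound y² ≤ k + c·y transfers
-- to every t ≤ y with c ≤ 2t.
quadratic-threshold : ∀ {t y} c k → t ≤ y → c ≤ 2 * t → y * y ≤ k + c * y → t * t ≤ k + c * t
quadratic-threshold {t} {y} c k t≤y c≤2t y²≤ = +-cancelʳ-≤ (c * d) (t * t) (k + c * t) (begin
  t * t + c * d            ≤⟨ +-monoʳ-≤ (t * t) (*-monoˡ-≤ d (≤-trans c≤2t (m≤m+n (2 * t) d))) ⟩
  t * t + (2 * t + d) * d  ≡⟨ square-of-sum t d ⟩
  (t + d) * (t + d)        ≡⟨ cong (λ z → z * z) t+d≡y ⟩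
  y * y                    ≤⟨ y²≤ ⟩
  k + c * y                ≡⟨ cong (λ z → k + c * z) t+d≡y ⟨
  k + c * (t + d)          ≡⟨ distribute k c t d ⟩
  k + c * t + c * d        ∎)
  where
  open ≤-Reasoning
  d : ℕ
  d = y ∸ t
  t+d≡y : t + d ≡ y
  t+d≡y = m+[n∸m]≡n t≤y
  square-of-sum : ∀ t d → t * t + (2 * t + d) * d ≡ (t + d) * (t + d)
  square-of-sum = solve-∀
  distribute : ∀ k c t d → k + c * (t + d) ≡ k + c * t + c * d
  distribute = solve-∀

at-least-four : ∀ n d → 3 * n + 8 ≤ 5 * d → d ≤ n → 4 ≤ n
at-least-four n d 3n+8≤5d d≤n = *-cancelˡ-≤ 2 (+-cancelˡ-≤ (3 * n) (2 * 4) (2 * n) (begin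
  3 * n + 8     ≤⟨ 3n+8≤5d ⟩
  5 * d         ≤⟨ *-monoʳ-≤ 5 d≤n ⟩
  5 * n         ≡⟨ split n ⟩
  3 * n + 2 * n ∎))
  where
  open ≤-Reasoning
  split : ∀ n → 5 * n ≡ 3 * n + 2 * n
  split = solve-∀

-- From 5s + 3a + 8 ≤ 5a, i.e. 5s ≤ 2a − 8, we get 25(s + s²) = 5s(5s + 5) ≤ (2a − 8)(2a − 3).
missing-colours-bound : ∀ {a} s → 4 ≤ a → 5 * s + (3 * a + 8) ≤ 5 * a →
  25 * (s + s * s) ≤ (2 * (a ∸ 4)) * (2 * (a ∸ 4) + 5)
missing-colours-bound {suc (suc (suc (suc p)))} s (s≤s (s≤s (s≤s (s≤s _)))) bound = begin
  25 * (s + s * s)         ≡⟨ rescale s ⟩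
  (5 * s) * (5 * s + 5)    ≤⟨ *-mono-≤ 5s≤2p (+-monoˡ-≤ 5 5s≤2p) ⟩
  (2 * p) * (2 * p + 5)    ∎
  where
  open ≤-Reasoning
  rescale : ∀ s → 25 * (s + s * s) ≡ (5 * s) * (5 * s + 5)
  rescale = solve-∀
  expand : ∀ s p → 5 * s + (3 * (4 + p) + 8) ≡ 5 * s + (20 + 3 * p)
  expand = solve-∀
  total : ∀ p → 5 * (4 + p) ≡ 2 * p + (20 + 3 * p)
  total = solve-∀
  5s≤2p : 5 * s ≤ 2 * p
  5s≤2p = +-cancelʳ-≤ (20 + 3 * p) (5 * s) (2 * p) (subst₂ _≤_ (expand s p) (total p) bound)

-- With a = |A|, b = |B| ≥ 4, X = e(H), Gs = Σ codegrees ≤ 3a(a − 1),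
-- Ss = Σ (s + s²) ≤ b(2a − 8)(2a − 3)/25 and X ≥ a(3b + 8)/5, the bound X² ≤ b(Gs + X + Ss)
-- is violated: by quadratic-threshold it suffices to check it at X = a(3b + 8)/5, where it is a
-- polynomial inequality in a − 4 and b − 4 with positive coefficients.
degree-conditions-incompatible : ∀ {a b} X Gs Ss → 4 ≤ a → 4 ≤ b →
  X * X ≤ b * (Gs + (X + Ss)) →
  Gs + a * 3 ≤ a * (a * 3) →
  25 * Ss ≤ b * ((2 * (a ∸ 4)) * (2 * (a ∸ 4) + 5)) →
  a * (3 * b + 8) ≤ 5 * X → ⊥
degree-conditions-incompatible {suc (suc (suc (suc p)))} {suc (suc (suc (suc q)))} X Gs Ss
  (s≤s (s≤s (s≤s (s≤s _)))) (s≤s (s≤s (s≤s (s≤s _)))) X²≤ Gs+3a≤3a² Ss≤ E≤5X =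
  <⇒≱ E²>K+5bE (quadratic-threshold (5 * b) K E≤5X 5b≤2E (begin
    (5 * X) * (5 * X)                          ≡⟨ scale X ⟩
    25 * (X * X)                               ≤⟨ *-monoʳ-≤ 25 X²≤ ⟩
    25 * (b * (Gs + (X + Ss)))                 ≡⟨ expand b Gs X Ss ⟩
    25 * b * Gs + b * (25 * Ss) + 5 * b * (5 * X)
      ≤⟨ +-monoˡ-≤ (5 * b * (5 * X)) (+-mono-≤ (*-monoʳ-≤ (25 * b) Gs≤) (*-monoʳ-≤ b Ss≤)) ⟩
    25 * b * (3 * (a * (3 + p))) + b * (b * ((2 * p) * (2 * p + 5))) + 5 * b * (5 * X)
      ≡⟨ cong (_+ 5 * b * (5 * X)) (collect p q) ⟩
    K + 5 * b * (5 * X)                        ∎))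
  where
  open ≤-Reasoning
  a b E K : ℕ
  a = 4 + p
  b = 4 + q
  E = a * (3 * b + 8)
  K = 75 * (a * b * (3 + p)) + b * (b * ((2 * p) * (2 * p + 5)))
  scale : ∀ X → (5 * X) * (5 * X) ≡ 25 * (X * X)
  scale = solve-∀
  expand : ∀ b Gs X Ss → 25 * (b * (Gs + (X + Ss))) ≡ 25 * b * Gs + b * (25 * Ss) + 5 * b * (5 * X)
  expand = solve-∀
  collect : ∀ p q → 25 * (4 + q) * (3 * ((4 + p) * (3 + p))) + (4 + q) * ((4 + q) * ((2 * p) * (2 * p + 5)))
    ≡ 75 * ((4 + p) * (4 + q) * (3 + p)) + (4 + q) * ((4 + q) * ((2 * p) * (2 * p + 5)))
  collect = solve-∀
  -- the diagonal u₁ = u₂ contributes nothing: Gs ≤ 3a(a − 1)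
  Gs≤ : Gs ≤ 3 * (a * (3 + p))
  Gs≤ = +-cancelʳ-≤ (a * 3) Gs (3 * (a * (3 + p))) (subst (Gs + a * 3 ≤_) (off-diagonal p) Gs+3a≤3a²)
    where
    off-diagonal : ∀ p → (4 + p) * ((4 + p) * 3) ≡ 3 * ((4 + p) * (3 + p)) + (4 + p) * 3
    off-diagonal = solve-∀
  5b≤2E : 5 * b ≤ 2 * E
  5b≤2E = subst (5 * b ≤_) (twice p q) (m≤m+n (5 * b) _)
    where
    twice : ∀ p q → 5 * (4 + q) + (140 + 19 * q + 40 * p + 6 * p * q) ≡ 2 * ((4 + p) * (3 * (4 + q) + 8))
    twice = solve-∀
  -- E² exceeds K + 5bE: the difference is a polynomial in p, q with positive coefficients
  E²>K+5bE : K + 5 * b * E < E * E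
  E²>K+5bE = subst (K + 5 * b * E <_) (sym (excess p q)) (s≤s (m≤m+n (K + 5 * b * E) _))
    where
    excess : ∀ p q → ((4 + p) * (3 * (4 + q) + 8)) * ((4 + p) * (3 * (4 + q) + 8)) ≡
      suc (75 * ((4 + p) * (4 + q) * (3 + p)) + (4 + q) * ((4 + q) * ((2 * p) * (2 * p + 5)))
        + 5 * (4 + q) * ((4 + p) * (3 * (4 + q) + 8))
        + ((4 + p) * (4 + p) * (36 + 13 * q + 5 * q * q) + (4 + q) * (4 + q) * (4 + 7 * p)
           + (559 + 35 * p * q + 140 * p + 140 * q)))
    excess = solve-∀

module RepresentativeSubgraph {a b} (G : BipColGraph a b) where

  H : Fin a → Fin b → Bool
  H u = FirstOccurrences.first (adj G u) (col G u)

  R : Fin b → Fin a → Bool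
  R v = FirstOccurrences.first (λ u → adj G u v) (λ u → col G u v)

  H⇒adj : ∀ {u v} → T (H u v) → T (adj G u v)
  H⇒adj {u} = FirstOccurrences.first⇒adj (adj G u) (col G u)

  H-rainbow : ∀ u → ColourClasses.Rainbow (col G u) (H u)
  H-rainbow u = FirstOccurrences.first-rainbow (adj G u) (col G u)

  R-rainbow : ∀ v → ColourClasses.Rainbow (λ u → col G u v) (R v)
  R-rainbow v = FirstOccurrences.first-rainbow (λ u → adj G u v) (λ u → col G u v)

  dcA≤H-degree : ∀ u → dcA G u ≤ count (H u)
  dcA≤H-degree u = FirstOccurrences.distinct-colours≤first (adj G u) (col G u)

  dcB≤R-size : ∀ v → dcB G v ≤ count (R v)
  dcB≤R-size v = FirstOccurrences.distinct-colours≤first (λ u → adj G u v) (λ u → col G u v)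

  common : Fin a → Fin a → Fin b → Bool
  common u₁ u₂ v = H u₁ v ∧ H u₂ v ∧ not (col G u₁ v ≡ᵇ col G u₂ v)

  codegree : Fin a → Fin a → ℕ
  codegree u₁ u₂ = count (common u₁ u₂)

  common-sound : ∀ {u₁ u₂ v} → T (common u₁ u₂ v) →
    T (H u₁ v) × T (H u₂ v) × col G u₁ v ≢ col G u₂ v
  common-sound {u₁} {u₂} {v} t =
    let (H₁ , rest) = Equivalence.to T-∧ t
        (H₂ , differ) = Equivalence.to (T-∧ {H u₂ v}) rest
    in H₁ , H₂ , λ same → T-not⇒¬T differ (≡⇒≡ᵇ (col G u₁ v) (col G u₂ v) same)

  codegree-self : ∀ u → codegree u u ≡ 0
  codegree-self u = count-none (common u u) (λ v t → let (_ , _ , differ) = common-sound t in differ refl)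

  -- Given a good common neighbour v₁, a second one v closes a rainbow C4 u₁ v₁ u₂ v unless it clashes:
  -- v = v₁, or u₂v repeats the colour of u₁v₁, or u₁v repeats the colour of u₂v₁.  As the H-stars are
  -- rainbow, each kind of clash occurs at most once.
  module _ (u₁ u₂ : Fin a) (v₁ : Fin b) where

    same-vertex repeat-at-u₂ repeat-at-u₁ clash : Fin b → Bool
    same-vertex v = isYes (v ≟ᶠ v₁)
    repeat-at-u₂ v = H u₂ v ∧ (col G u₂ v ≡ᵇ col G u₁ v₁)
    repeat-at-u₁ v = H u₁ v ∧ (col G u₁ v ≡ᵇ col G u₂ v₁)
    clash v = same-vertex v ∨ repeat-at-u₂ v ∨ repeat-at-u₁ v

    clashes≤3 : count clash ≤ 3
    clashes≤3 = begin
      count clash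
        ≤⟨ count-∨ same-vertex (λ v → repeat-at-u₂ v ∨ repeat-at-u₁ v) ⟩
      count same-vertex + count (λ v → repeat-at-u₂ v ∨ repeat-at-u₁ v)
        ≤⟨ +-monoʳ-≤ (count same-vertex) (count-∨ repeat-at-u₂ repeat-at-u₁) ⟩
      count same-vertex + (count repeat-at-u₂ + count repeat-at-u₁)
        ≤⟨ +-mono-≤ (count-≤1 same-vertex (λ i j i≡v₁ j≡v₁ → trans (toWitness i≡v₁) (sym (toWitness j≡v₁))))
                    (+-mono-≤ (ColourClasses.rainbow-colour-once (col G u₂) (H-rainbow u₂) (col G u₁ v₁))
                              (ColourClasses.rainbow-colour-once (col G u₁) (H-rainbow u₁) (col G u₂ v₁))) ⟩
      3 ∎
      where open ≤-Reasoning

    no-clash : ∀ {v} → ¬ T (clash v) →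
      v ≢ v₁ × (T (H u₂ v) → col G u₂ v ≢ col G u₁ v₁) × (T (H u₁ v) → col G u₁ v ≢ col G u₂ v₁)
    no-clash {v} ¬clash =
        (λ v≡v₁ → ¬clash (inˡ (same-vertex v) _ (fromWitness v≡v₁)))
      , (λ H₂ same → ¬clash (inʳ (same-vertex v) _ (inˡ (repeat-at-u₂ v) (repeat-at-u₁ v)
          (Equivalence.from T-∧ (H₂ , ≡⇒≡ᵇ _ _ same)))))
      , (λ H₁ same → ¬clash (inʳ (same-vertex v) _ (inʳ (repeat-at-u₂ v) (repeat-at-u₁ v)
          (Equivalence.from T-∧ (H₁ , ≡⇒≡ᵇ _ _ same)))))
      where
      inˡ : ∀ x y → T x → T (x ∨ y)
      inˡ x y t = Equivalence.from (T-∨ {x} {y}) (inj₁ t)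
      inʳ : ∀ x y → T y → T (x ∨ y)
      inʳ x y t = Equivalence.from (T-∨ {x} {y}) (inj₂ t)

  close-C4 : ∀ u₁ u₂ v₁ v₂ → T (common u₁ u₂ v₁) → T (common u₁ u₂ v₂) → ¬ T (clash u₁ u₂ v₁ v₂) →
    RainbowC4 G
  close-C4 u₁ u₂ v₁ v₂ common₁ common₂ ¬clash =
    let H₁₁ , H₂₁ , c₁₁≢c₂₁ = common-sound common₁
        H₁₂ , H₂₂ , c₁₂≢c₂₂ = common-sound common₂
        v₂≢v₁ , c₂₂≢c₁₁ , c₁₂≢c₂₁ = no-clash u₁ u₂ v₁ ¬clash
        v₁≢v₂ = ≢-sym v₂≢v₁
    in u₁ , u₂ , v₁ , v₂ , (λ { refl → c₁₁≢c₂₁ refl }) , v₁≢v₂ ,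
       H⇒adj H₁₁ , H⇒adj H₂₁ , H⇒adj H₂₂ , H⇒adj H₁₂ ,
       c₁₁≢c₂₁ , ≢-sym (c₂₂≢c₁₁ H₂₂) , (λ e → v₁≢v₂ (H-rainbow u₁ v₁ v₂ H₁₁ H₁₂ e)) ,
       (λ e → v₁≢v₂ (H-rainbow u₂ v₁ v₂ H₂₁ H₂₂ e)) , ≢-sym (c₁₂≢c₂₁ H₁₂) , ≢-sym c₁₂≢c₂₂

  -- Four good common neighbours leave one that does not clash with the first.
  rainbow-C4 : ∀ u₁ u₂ → 4 ≤ codegree u₁ u₂ → RainbowC4 G
  rainbow-C4 u₁ u₂ 4≤codegree =
    let v₁ , common₁ = count-positive (common u₁ u₂) (≤-trans (s≤s z≤n) 4≤codegree)
        v₂ , common₂ , ¬clash = escape (common u₁ u₂) (clash u₁ u₂ v₁)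
                                       (≤-<-trans (clashes≤3 u₁ u₂ v₁) 4≤codegree)
    in close-C4 u₁ u₂ v₁ v₂ common₁ common₂ ¬clash

  H-degree unrepresented : Fin b → ℕ
  H-degree v = count (λ u → H u v)
  unrepresented v = count (λ u → H u v ∧ not (R v u))

  different-colour-pairs : Fin b → ℕ
  different-colour-pairs v =
    pairSum (ColourClasses.differ (λ u → col G u v)) (λ u → ι (H u v)) (λ u → ι (H u v))

  edges codegree-total unrepresented-total : ℕ
  edges = ∑[ v < b ] H-degree v
  codegree-total = ∑[ u₁ < a ] ∑[ u₂ < a ] codegree u₁ u₂
  unrepresented-total = ∑[ v < b ] (unrepresented v + unrepresented v * unrepresented v)

  edges-lower-bound : (∀ u → 3 * b + 8 ≤ 5 * dcA G u) → a * (3 * b + 8) ≤ 5 * edges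
  edges-lower-bound dcA-large = begin
    a * (3 * b + 8)                  ≡⟨ ∑-const a (3 * b + 8) ⟨
    ∑[ u < a ] (3 * b + 8)           ≤⟨ ∑-mono-≤ (λ u → ≤-trans (dcA-large u) (*-monoʳ-≤ 5 (dcA≤H-degree u))) ⟩
    ∑[ u < a ] (5 * count (H u))     ≡⟨ ∑-*ˡ 5 (λ u → count (H u)) ⟩
    5 * ∑[ u < a ] count (H u)       ≡⟨ cong (5 *_) (∑-comm (λ u v → ι (H u v))) ⟩
    5 * edges                        ∎
    where open ≤-Reasoning

  -- Counting the triples (u₁, u₂, v) with v a good common neighbour of u₁, u₂ in two ways.
  pairs-total : ∑[ v < b ] different-colour-pairs v ≡ codegree-total
  pairs-total = begin
    ∑[ v < b ] ∑[ u₁ < a ] ∑[ u₂ < a ] term u₁ u₂ v ≡⟨ ∑-comm (λ v u₁ → ∑[ u₂ < a ] term u₁ u₂ v) ⟩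
    ∑[ u₁ < a ] ∑[ v < b ] ∑[ u₂ < a ] term u₁ u₂ v ≡⟨ sum-cong-≗ (λ u₁ → ∑-comm (λ v u₂ → term u₁ u₂ v)) ⟩
    ∑[ u₁ < a ] ∑[ u₂ < a ] ∑[ v < b ] term u₁ u₂ v ≡⟨ sum-cong-≗ (λ u₁ → sum-cong-≗ (λ u₂ → sum-cong-≗ (λ v → ι-common u₁ u₂ v))) ⟨
    codegree-total                                  ∎
    where
    open ≡-Reasoning
    term : Fin a → Fin a → Fin b → ℕ
    term u₁ u₂ v = ι (H u₁ v) * ι (H u₂ v) * ι (not (col G u₁ v ≡ᵇ col G u₂ v))
    ι-common : ∀ u₁ u₂ v → ι (common u₁ u₂ v) ≡ term u₁ u₂ v
    ι-common u₁ u₂ v = begin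
      ι (H u₁ v ∧ (H u₂ v ∧ not e))    ≡⟨ ι-∧ (H u₁ v) _ ⟩
      ι (H u₁ v) * ι (H u₂ v ∧ not e)  ≡⟨ cong (ι (H u₁ v) *_) (ι-∧ (H u₂ v) (not e)) ⟩
      ι (H u₁ v) * (ι (H u₂ v) * ι (not e)) ≡⟨ *-assoc (ι (H u₁ v)) _ _ ⟨
      term u₁ u₂ v                     ∎
      where
      e : Bool
      e = col G u₁ v ≡ᵇ col G u₂ v

  -- Without four good common neighbours, Σ codegree ≤ 3a(a − 1) (the diagonal vanishes).
  codegree-total-bound : (∀ u₁ u₂ → codegree u₁ u₂ ≤ 3) → codegree-total + a * 3 ≤ a * (a * 3)
  codegree-total-bound codegree≤3 = begin
    codegree-total + a * 3                                 ≡⟨ cong (codegree-total +_) (∑-const a 3) ⟨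
    codegree-total + ∑[ u₁ < a ] 3                         ≡⟨ ∑-distrib-+ (λ u₁ → ∑[ u₂ < a ] codegree u₁ u₂) (λ _ → 3) ⟨
    ∑[ u₁ < a ] (∑[ u₂ < a ] codegree u₁ u₂ + 3)           ≤⟨ ∑-mono-≤ (λ u₁ → ∑-vanishing-term 3 (codegree u₁) u₁ (codegree≤3 u₁) (codegree-self u₁)) ⟩
    ∑[ u₁ < a ] (a * 3)                                    ≡⟨ ∑-const a (a * 3) ⟩
    a * (a * 3)                                            ∎
    where open ≤-Reasoning

  -- Cauchy–Schwarz and the colour-class bound at every v: e(H)² ≤ b·Σ x_v² ≤ b(Σ codegree + e(H) + Σ (s_v + s_v²)).
  square-sum-bound : edges * edges ≤ b * (codegree-total + (edges + unrepresented-total))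
  square-sum-bound = begin
    edges * edges                                         ≤⟨ cauchy-schwarz H-degree ⟩
    b * ∑[ v < b ] (H-degree v * H-degree v)              ≤⟨ *-monoʳ-≤ b (∑-mono-≤ at-vertex) ⟩
    b * ∑[ v < b ] (different-colour-pairs v + (H-degree v + t v))
      ≡⟨ cong (b *_) (trans (∑-distrib-+ different-colour-pairs (λ v → H-degree v + t v))
                            (cong₂ _+_ pairs-total (∑-distrib-+ H-degree t))) ⟩
    b * (codegree-total + (edges + unrepresented-total))  ∎
    where
    open ≤-Reasoning
    t : Fin b → ℕ
    t v = unrepresented v + unrepresented v * unrepresented v
    at-vertex : ∀ v → H-degree v * H-degree v ≤ different-colour-pairs v + (H-degree v + t v)
    at-vertex v = ColourClasses.local-bound (λ u → col G u v) (λ u → H u v) (R v) (R-rainbow v)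

  -- The first edges at v realise dcB v colours and are disjoint from the unrepresented H-edges.
  unrepresented+dcB≤a : ∀ v → unrepresented v + dcB G v ≤ a
  unrepresented+dcB≤a v = begin
    unrepresented v + dcB G v                       ≤⟨ +-mono-≤ (count-mono {Q = λ u → not (R v u)} (λ u t → proj₂ (Equivalence.to (T-∧ {H u v}) t))) (dcB≤R-size v) ⟩
    count (λ u → not (R v u)) + count (R v)         ≡⟨ count-complement (R v) ⟩
    a                                               ∎
    where open ≤-Reasoning

  unrepresented-total-bound : 4 ≤ a → (∀ v → 3 * a + 8 ≤ 5 * dcB G v) →
    25 * unrepresented-total ≤ b * ((2 * (a ∸ 4)) * (2 * (a ∸ 4) + 5))
  unrepresented-total-bound 4≤a dcB-large = begin
    25 * unrepresented-total                     ≡⟨ ∑-*ˡ 25 (λ v → unrepresented v + unrepresented v * unrepresented v) ⟨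
    ∑[ v < b ] (25 * (unrepresented v + unrepresented v * unrepresented v))
      ≤⟨ ∑-mono-≤ (λ v → missing-colours-bound (unrepresented v) 4≤a (per-vertex v)) ⟩
    ∑[ v < b ] ((2 * (a ∸ 4)) * (2 * (a ∸ 4) + 5)) ≡⟨ ∑-const b _ ⟩
    b * ((2 * (a ∸ 4)) * (2 * (a ∸ 4) + 5))      ∎
    where
    open ≤-Reasoning
    per-vertex : ∀ v → 5 * unrepresented v + (3 * a + 8) ≤ 5 * a
    per-vertex v = ≤-trans (+-monoʳ-≤ (5 * unrepresented v) (dcB-large v))
      (≤-trans (≤-reflexive (sym (*-distribˡ-+ 5 (unrepresented v) (dcB G v))))
               (*-monoʳ-≤ 5 (unrepresented+dcB≤a v)))

  module _ (dcA-large : ∀ u → 3 * b + 8 ≤ 5 * dcA G u) (dcB-large : ∀ v → 3 * a + 8 ≤ 5 * dcB G v) where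

    A-large : 0 < b → 4 ≤ a
    A-large b>0 = at-least-four a (dcB G v) (dcB-large v) (≤-trans (dcB≤R-size v) (count-≤-size (R v)))
      where
      v : Fin b
      v = fromℕ< b>0

    B-large : 0 < a → 4 ≤ b
    B-large a>0 = at-least-four b (dcA G u) (dcA-large u) (≤-trans (dcA≤H-degree u) (count-≤-size (H u)))
      where
      u : Fin a
      u = fromℕ< a>0

    both-parts-large : 0 < a + b → 4 ≤ a × 4 ≤ b
    both-parts-large a+b>0 with 0 <? a
    ... | yes a>0 = A-large (≤-trans (s≤s z≤n) (B-large a>0)) , B-large a>0
    ... | no a≯0 = A-large b>0 , B-large (≤-trans (s≤s z≤n) (A-large b>0))
      where
      b>0 : 0 < b
      b>0 = subst (λ z → 0 < z + b) (n≤0⇒n≡0 (≮⇒≥ a≯0)) a+b>0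

theorem10 : (a b : ℕ) → 0 < a + b → (G : BipColGraph a b) →
    (∀ u → 3 * b + 8 ≤ 5 * dcA G u) →
    (∀ v → 3 * a + 8 ≤ 5 * dcB G v) →
    RainbowC4 G
theorem10 a b a+b>0 G dcA-large dcB-large =
  case any? (λ u₁ → any? (λ u₂ → 4 ≤? codegree u₁ u₂)) of λ where
    (yes (u₁ , u₂ , 4≤codegree)) → rainbow-C4 u₁ u₂ 4≤codegree
    (no no-dense-pair) → ⊥-elim (degree-conditions-incompatible edges codegree-total unrepresented-total
      4≤a 4≤b square-sum-bound
      (codegree-total-bound (λ u₁ u₂ → ≤-pred (≰⇒> (λ 4≤codegree → no-dense-pair (u₁ , u₂ , 4≤codegree)))))
      (unrepresented-total-bound 4≤a dcB-large)
      (edges-lower-bound dcA-large))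
  where
  open RepresentativeSubgraph G
  4≤a : 4 ≤ a
  4≤a = proj₁ (both-parts-large dcA-large dcB-large a+b>0)
  4≤b : 4 ≤ b
  4≤b = proj₂ (both-parts-large dcA-large dcB-large a+b>0)
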